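{- For every $d>0$ that is realized as the Euclidean distance between two points of $\mathbb{Q}^3$, the complete bipartite graph $K_{2,3}$ is (isomorphic to) a subgraph of $G(\mathbb{Q}^3,d)$.
   Context: For $S \subseteq \mathbb{R}$, a positive integer $n$ and $d>0$, $G(S^n,d)$ denotes the graph with vertex set $S^n$ in which two vertices are adjacent if and only if their Euclidean distance is exactly $d$. Subgraphs need not be induced. -}

module Defs where

open import Data.Rational using (ℚ; _+_; _*_; _-_)
open import Data.Product using (_×_; _,_; ∃)
open import Data.Sum using (_⊎_; inj₁; inj₂)
open import Data.Fin using (Fin)
open import Data.Empty using (⊥)
open import Data.Unit using (⊤)
open import Relation.Binary.PropositionalEquality using (_≡_)
open import Function.Definitions using (Injective)

ℚ³ : Set
ℚ³ = ℚ × ℚ × ℚ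

sqDist : ℚ³ → ℚ³ → ℚ
sqDist (x₁ , y₁ , z₁) (x₂ , y₂ , z₂) =
  ((x₁ - x₂) * (x₁ - x₂) + (y₁ - y₂) * (y₁ - y₂)) + (z₁ - z₂) * (z₁ - z₂)

-- Adjacency in G(ℚ³, d), where d is given through d² = dsq (d > 0):
-- two points are adjacent iff their Euclidean distance is exactly d,
-- i.e. iff their squared distance equals d².
DistAdj : ℚ → ℚ³ → ℚ³ → Set
DistAdj dsq u v = sqDist u v ≡ dsq

K23 : Set
K23 = Fin 2 ⊎ Fin 3

K23Adj : K23 → K23 → Set
K23Adj (inj₁ _) (inj₂ _) = ⊤
K23Adj (inj₂ _) (inj₁ _) = ⊤
K23Adj (inj₁ _) (inj₁ _) = ⊥
K23Adj (inj₂ _) (inj₂ _) = ⊥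

-- K_{2,3} is (isomorphic to) a (not necessarily induced) subgraph of
-- G(ℚ³, d): an injective vertex map sending edges to edges.
K23SubgraphOfDistGraph : ℚ → Set
K23SubgraphOfDistGraph dsq =
  ∃ λ (f : K23 → ℚ³) →
    Injective _≡_ _≡_ f × (∀ u v → K23Adj u v → DistAdj dsq (f u) (f v))

{-# OPTIONS --safe #-}
-- Up to permuting coordinates the difference vector is (x , w) with x ∈ ℚ
-- nonzero and w ∈ ℚ²; if w = 0, replace it by (3x/5 , 4x/5 , 0), of the same
-- length, so that w ≠ 0 as well.  The quarter turn ρ of the (y , z)-plane is an
-- isometry fixing the x-axis, so 0 and (2x , 0 , 0), mirror images in the plane
-- through (x , w) perpendicular to the axis, are both at distance d from
-- (x , w), (x , ρw) and (x , ρ²w); these are distinct because ρ and ρ² fix only 0.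
module Submission where

open import Defs
open import Algebra.Properties.Group using (x∙y⁻¹≈ε⇒x≈y; identityʳ-unique)
open import Data.Fin using (Fin; zero; suc)
import Data.Integer as ℤ
open import Data.Product using (_×_; _,_; ∃; proj₁)
open import Data.Product.Properties using (≡-dec; ,-injectiveˡ; ,-injectiveʳ)
open import Data.Rational using (ℚ; _+_; _*_; _-_; -_; _/_; 1/_; 0ℚ; 1ℚ; ½; _≟_; NonZero)
open import Data.Rational.Properties
  using (+-0-group; +-inverseʳ; neg-injective; *-zeroʳ; *-identityˡ; *-inverseˡ; *-assoc)
open import Data.Rational.Solver using (module +-*-Solver)
open import Data.Empty using (⊥-elim)
open import Data.Sum using (inj₁; inj₂; [_,_])
open import Function.Base using (_∘_)
open import Function.Definitions using (Injective)
open import Relation.Binary.PropositionalEquality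
  using (_≡_; _≢_; refl; sym; trans; cong; cong₂; subst; module ≡-Reasoning)
open import Relation.Nullary using (yes; no)

open +-*-Solver

ℚ² : Set
ℚ² = ℚ × ℚ

0² : ℚ²
0² = 0ℚ , 0ℚ

0³ : ℚ³
0³ = 0ℚ , 0²

planeNorm² : ℚ² → ℚ
planeNorm² (u , v) = u * u + v * v

norm² : ℚ³ → ℚ
norm² (x , y , z) = (x * x + y * y) + z * z

_−³_ : ℚ³ → ℚ³ → ℚ³
(x₁ , y₁ , z₁) −³ (x₂ , y₂ , z₂) = x₁ - x₂ , y₁ - y₂ , z₁ - z₂

sqDist≡norm²−³ : ∀ p q → sqDist p q ≡ norm² (p −³ q)
sqDist≡norm²−³ p q = refl

sub≡0⇒≡ : ∀ {p q} → p - q ≡ 0ℚ → p ≡ q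
sub≡0⇒≡ {p} {q} = x∙y⁻¹≈ε⇒x≈y +-0-group p q

x+x≡x⇒x≡0 : ∀ {x} → x + x ≡ x → x ≡ 0ℚ
x+x≡x⇒x≡0 {x} = identityʳ-unique +-0-group x x

x+x≡0⇒x≡0 : ∀ {x} → x + x ≡ 0ℚ → x ≡ 0ℚ
x+x≡0⇒x≡0 {x} x+x≡0 = begin
  x            ≡⟨ solve 1 (λ x → x := con ½ :* (x :+ x)) refl x ⟩
  ½ * (x + x)  ≡⟨ cong (½ *_) x+x≡0 ⟩
  ½ * 0ℚ       ≡⟨ *-zeroʳ ½ ⟩
  0ℚ           ∎
  where open ≡-Reasoning

*-nonZero : ∀ c .{{_ : NonZero c}} {x} → x ≢ 0ℚ → c * x ≢ 0ℚ
*-nonZero c {x} x≢0 cx≡0 = x≢0 (begin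
  x                 ≡⟨ sym (*-identityˡ x) ⟩
  1ℚ * x            ≡⟨ cong (_* x) (sym (*-inverseˡ c)) ⟩
  (1/ c * c) * x    ≡⟨ *-assoc (1/ c) c x ⟩
  1/ c * (c * x)    ≡⟨ cong (1/ c *_) cx≡0 ⟩
  1/ c * 0ℚ         ≡⟨ *-zeroʳ (1/ c) ⟩
  0ℚ                ∎)
  where open ≡-Reasoning

-x≡x⇒x≡0 : ∀ {x} → - x ≡ x → x ≡ 0ℚ
-x≡x⇒x≡0 {x} -x≡x = x+x≡0⇒x≡0 (trans (cong (x +_) (sym -x≡x)) (+-inverseʳ x))

sqDist-sym : ∀ p q → sqDist p q ≡ sqDist q p
sqDist-sym (x₁ , y₁ , z₁) (x₂ , y₂ , z₂) =
  solve 6 (λ x₁ y₁ z₁ x₂ y₂ z₂ →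
      ((x₁ :- x₂) :* (x₁ :- x₂) :+ (y₁ :- y₂) :* (y₁ :- y₂)) :+ (z₁ :- z₂) :* (z₁ :- z₂)
    := ((x₂ :- x₁) :* (x₂ :- x₁) :+ (y₂ :- y₁) :* (y₂ :- y₁)) :+ (z₂ :- z₁) :* (z₂ :- z₁))
    refl x₁ y₁ z₁ x₂ y₂ z₂

−³≡0³⇒≡ : ∀ p q → p −³ q ≡ 0³ → p ≡ q
−³≡0³⇒≡ (x₁ , y₁ , z₁) (x₂ , y₂ , z₂) e =
  cong₂ _,_ (sub≡0⇒≡ (,-injectiveˡ e))
    (cong₂ _,_ (sub≡0⇒≡ (,-injectiveˡ (,-injectiveʳ e))) (sub≡0⇒≡ (,-injectiveʳ (,-injectiveʳ e))))

quarterTurn : ℚ² → ℚ²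
quarterTurn (u , v) = - v , u

quarterTurn-injective : Injective _≡_ _≡_ quarterTurn
quarterTurn-injective e =
  cong₂ _,_ (,-injectiveʳ e) (neg-injective (,-injectiveˡ e))

quarterTurn-fixed⇒0² : ∀ {w} → quarterTurn w ≡ w → w ≡ 0²
quarterTurn-fixed⇒0² {u , v} e = cong₂ _,_ (trans u≡v v≡0) v≡0
  where
  u≡v : u ≡ v
  u≡v = ,-injectiveʳ e
  v≡0 : v ≡ 0ℚ
  v≡0 = -x≡x⇒x≡0 (trans (,-injectiveˡ e) u≡v)

halfTurn-fixed⇒0² : ∀ {w} → quarterTurn (quarterTurn w) ≡ w → w ≡ 0²
halfTurn-fixed⇒0² e =
  cong₂ _,_ (-x≡x⇒x≡0 (,-injectiveˡ e)) (-x≡x⇒x≡0 (,-injectiveʳ e))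

planeNorm²-quarterTurn : ∀ w → planeNorm² (quarterTurn w) ≡ planeNorm² w
planeNorm²-quarterTurn (u , v) =
  solve 2 (λ u v → (:- v) :* (:- v) :+ u :* u := u :* u :+ v :* v) refl u v

turn : Fin 3 → ℚ² → ℚ²
turn zero              w = w
turn (suc zero)        w = quarterTurn w
turn (suc (suc zero))  w = quarterTurn (quarterTurn w)

planeNorm²-turn : ∀ j w → planeNorm² (turn j w) ≡ planeNorm² w
planeNorm²-turn zero             w = refl
planeNorm²-turn (suc zero)       w = planeNorm²-quarterTurn w
planeNorm²-turn (suc (suc zero)) w =
  trans (planeNorm²-quarterTurn (quarterTurn w)) (planeNorm²-quarterTurn w)

turn-injective : ∀ {w} → w ≢ 0² → ∀ {j k} → turn j w ≡ turn k w → j ≡ k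
turn-injective {w} w≢0 {j} {k} = go j k
  where
  go : ∀ j k → turn j w ≡ turn k w → j ≡ k
  go zero             zero             _ = refl
  go (suc zero)       (suc zero)       _ = refl
  go (suc (suc zero)) (suc (suc zero)) _ = refl
  go zero             (suc zero)       e = ⊥-elim (w≢0 (quarterTurn-fixed⇒0² (sym e)))
  go (suc zero)       zero             e = ⊥-elim (w≢0 (quarterTurn-fixed⇒0² e))
  go zero             (suc (suc zero)) e = ⊥-elim (w≢0 (halfTurn-fixed⇒0² (sym e)))
  go (suc (suc zero)) zero             e = ⊥-elim (w≢0 (halfTurn-fixed⇒0² e))
  go (suc zero)       (suc (suc zero)) e =
    ⊥-elim (w≢0 (quarterTurn-fixed⇒0² (sym (quarterTurn-injective e))))
  go (suc (suc zero)) (suc zero)       e =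
    ⊥-elim (w≢0 (quarterTurn-fixed⇒0² (quarterTurn-injective e)))

k23-subgraph : ∀ {d²} (a : Fin 2 → ℚ³) (c : Fin 3 → ℚ³) →
               Injective _≡_ _≡_ a → Injective _≡_ _≡_ c → (∀ i j → a i ≢ c j) →
               (∀ i j → DistAdj d² (a i) (c j)) → K23SubgraphOfDistGraph d²
k23-subgraph {d²} a c a-inj c-inj a≢c a~c = [ a , c ] , injective , adjacent
  where
  injective : Injective _≡_ _≡_ [ a , c ]
  injective {inj₁ i} {inj₁ j} e = cong inj₁ (a-inj e)
  injective {inj₁ i} {inj₂ j} e = ⊥-elim (a≢c i j e)
  injective {inj₂ i} {inj₁ j} e = ⊥-elim (a≢c j i (sym e))
  injective {inj₂ i} {inj₂ j} e = cong inj₂ (c-inj e)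

  adjacent : ∀ u v → K23Adj u v → DistAdj d² ([ a , c ] u) ([ a , c ] v)
  adjacent (inj₁ i) (inj₂ j) _ = a~c i j
  adjacent (inj₂ j) (inj₁ i) _ = trans (sqDist-sym (c j) (a i)) (a~c i j)

Oblique : ℚ³ → Set
Oblique (x , w) = x ≢ 0ℚ × w ≢ 0²

sqDist-axis : ∀ h x w → sqDist (h , 0²) (x , w) ≡ (h - x) * (h - x) + planeNorm² w
sqDist-axis h x (u , v) =
  solve 4 (λ h x u v →
      ((h :- x) :* (h :- x) :+ (con 0ℚ :- u) :* (con 0ℚ :- u)) :+ (con 0ℚ :- v) :* (con 0ℚ :- v)
    := (h :- x) :* (h :- x) :+ (u :* u :+ v :* v))
    refl h x u v

norm²-split : ∀ x w → norm² (x , w) ≡ x * x + planeNorm² w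
norm²-split x (u , v) =
  solve 3 (λ x u v → (x :* x :+ u :* u) :+ v :* v := x :* x :+ (u :* u :+ v :* v)) refl x u v

k23-oblique : ∀ p → Oblique p → K23SubgraphOfDistGraph (norm² p)
k23-oblique (x , w) (x≢0 , w≢0) =
  k23-subgraph apex rim apex-injective rim-injective apex≢rim apex~rim
  where
  height : Fin 2 → ℚ
  height zero       = 0ℚ
  height (suc zero) = x + x

  apex : Fin 2 → ℚ³
  apex i = height i , 0²

  rim : Fin 3 → ℚ³
  rim j = x , turn j w

  height≢x : ∀ i → height i ≢ x
  height≢x zero       e = x≢0 (sym e)
  height≢x (suc zero) e = x≢0 (x+x≡x⇒x≡0 e)

  height-offset : ∀ i → (height i - x) * (height i - x) ≡ x * x
  height-offset zero       =
    solve 1 (λ x → (con 0ℚ :- x) :* (con 0ℚ :- x) := x :* x) refl x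
  height-offset (suc zero) =
    solve 1 (λ x → ((x :+ x) :- x) :* ((x :+ x) :- x) := x :* x) refl x

  apex-injective : Injective _≡_ _≡_ apex
  apex-injective {zero}     {zero}     _ = refl
  apex-injective {suc zero} {suc zero} _ = refl
  apex-injective {zero}     {suc zero} e = ⊥-elim (x≢0 (x+x≡0⇒x≡0 (sym (,-injectiveˡ e))))
  apex-injective {suc zero} {zero}     e = ⊥-elim (x≢0 (x+x≡0⇒x≡0 (,-injectiveˡ e)))

  rim-injective : Injective _≡_ _≡_ rim
  rim-injective e = turn-injective w≢0 (,-injectiveʳ e)

  apex≢rim : ∀ i j → apex i ≢ rim j
  apex≢rim i j e = height≢x i (,-injectiveˡ e)

  apex~rim : ∀ i j → DistAdj (norm² (x , w)) (apex i) (rim j)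
  apex~rim i j = begin
    sqDist (apex i) (rim j)                                       ≡⟨ sqDist-axis (height i) x (turn j w) ⟩
    (height i - x) * (height i - x) + planeNorm² (turn j w)       ≡⟨ cong₂ _+_ (height-offset i) (planeNorm²-turn j w) ⟩
    x * x + planeNorm² w                                          ≡⟨ sym (norm²-split x w) ⟩
    norm² (x , w)                                                 ∎
    where open ≡-Reasoning

norm²-rotate : ∀ x y z → norm² (y , z , x) ≡ norm² (x , y , z)
norm²-rotate x y z =
  solve 3 (λ x y z → (y :* y :+ z :* z) :+ x :* x := (x :* x :+ y :* y) :+ z :* z) refl x y z

leading-nonzero : ∀ p → p ≢ 0³ → ∃ λ q → proj₁ q ≢ 0ℚ × norm² q ≡ norm² p
leading-nonzero (x , y , z) p≢0 with x ≟ 0ℚ | y ≟ 0ℚ | z ≟ 0ℚ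
... | no x≢0 | _        | _        = (x , y , z) , x≢0 , refl
... | yes _  | no y≢0   | _        = (y , z , x) , y≢0 , norm²-rotate x y z
... | yes _  | yes _    | no z≢0   =
  (z , x , y) , z≢0 , trans (norm²-rotate y z x) (norm²-rotate x y z)
... | yes refl | yes refl | yes refl = ⊥-elim (p≢0 refl)

three-fifths four-fifths : ℚ
three-fifths = ℤ.+ 3 / 5
four-fifths  = ℤ.+ 4 / 5

norm²-pythagorean : ∀ x → norm² (three-fifths * x , four-fifths * x , 0ℚ) ≡ norm² (x , 0²)
norm²-pythagorean =
  solve 1 (λ x →
      ((con three-fifths :* x) :* (con three-fifths :* x) :+ (con four-fifths :* x) :* (con four-fifths :* x))
        :+ con 0ℚ :* con 0ℚ
    := (x :* x :+ con 0ℚ :* con 0ℚ) :+ con 0ℚ :* con 0ℚ)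
    refl

oblique-with-leading : ∀ x w → x ≢ 0ℚ → ∃ λ q → Oblique q × norm² q ≡ norm² (x , w)
oblique-with-leading x w x≢0 with ≡-dec _≟_ _≟_ w 0²
... | no w≢0  = (x , w) , (x≢0 , w≢0) , refl
... | yes refl =
  (three-fifths * x , four-fifths * x , 0ℚ) ,
  (*-nonZero three-fifths x≢0 , *-nonZero four-fifths x≢0 ∘ ,-injectiveˡ) ,
  norm²-pythagorean x

oblique-of-norm² : ∀ p → p ≢ 0³ → ∃ λ q → Oblique q × norm² q ≡ norm² p
oblique-of-norm² p p≢0 with leading-nonzero p p≢0
... | (x , w) , x≢0 , same with oblique-with-leading x w x≢0
...   | q , oblique , same′ = q , oblique , trans same′ same

theorem3p3 : (p q : ℚ³) → p ≢ q → K23SubgraphOfDistGraph (sqDist p q)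
theorem3p3 p q p≢q with oblique-of-norm² (p −³ q) (p≢q ∘ −³≡0³⇒≡ p q)
... | o , oblique , same =
  subst K23SubgraphOfDistGraph (trans same (sym (sqDist≡norm²−³ p q))) (k23-oblique o oblique)
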